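{- Let $G$ be a graph with matching number $t$. Then \[mis(G)\leq 3^t,\] with equality if and only if $G\cong tK_3\cup rK_1$ for some natural number $r\geq 0$.
   Context: All graphs are finite and simple. An independent set of a graph is a set of pairwise non-adjacent vertices; a maximal independent set (MIS) is an independent set not properly contained in any other independent set. $mis(G)$ denotes the number of maximal independent sets of $G$. The matching number of $G$ is the maximum number of edges in a matching (set of pairwise disjoint edges) of $G$. $K_n$ denotes the complete graph on $n$ vertices; for graphs $G,H$, $G\cup H$ is their disjoint union and $kG$ is the disjoint union of $k$ copies of $G$. -}

module Defs where

open import Data.Nat using (ℕ; zero; suc; _+_; _≤_)
open import Data.Bool using (Bool; true; false; not; _∧_)
open import Data.Fin using (Fin; splitAt; _≟_)
open import Data.Fin.Subset using (Subset; _∈_; _∉_; _⊆_; inside; outside)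
open import Data.Fin.Subset.Properties using (_∈?_; _⊆?_; anySubset?)
open import Data.Fin.Properties using (all?)
open import Data.Sum using (_⊎_; inj₁; inj₂)
open import Data.Product using (Σ; ∃; _×_; _,_; proj₁; proj₂)
open import Data.List using (List; []; _∷_; _++_; map; length; filter)
open import Data.List.Relation.Unary.All using (All)
open import Data.List.Relation.Unary.Unique.Propositional using (Unique)
open import Data.Vec using (Vec; []; _∷_)
open import Function.Bundles using (_↔_; Inverse)
open import Relation.Nullary using (Dec; yes; no; ¬_; does)
open import Relation.Nullary.Decidable using (⌊_⌋; _→-dec_; _×-dec_; map′; ¬?; decidable-stable)
open import Relation.Binary.PropositionalEquality using (_≡_; refl; sym; trans; cong)
open import Data.Bool.Properties using () renaming (_≟_ to _≟ᵇ_)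

record Graph : Set where
  field
    n     : ℕ
    adj   : Fin n → Fin n → Bool
    adj-sym : ∀ i j → adj i j ≡ adj j i
    irrefl : ∀ i → adj i i ≡ false
open Graph public

≟-sym : ∀ {m} (i j : Fin m) → ⌊ i ≟ j ⌋ ≡ ⌊ j ≟ i ⌋
≟-sym i j with i ≟ j | j ≟ i
... | yes _ | yes _ = refl
... | no _  | no _  = refl
... | yes p | no q  = Data.Empty.⊥-elim (q (sym p)) where import Data.Empty
... | no p  | yes q = Data.Empty.⊥-elim (p (sym q)) where import Data.Empty

≟-refl : ∀ {m} (i : Fin m) → ⌊ i ≟ i ⌋ ≡ true
≟-refl i with i ≟ i
... | yes _ = refl
... | no p  = Data.Empty.⊥-elim (p refl) where import Data.Empty

K : ℕ → Graph
K m = record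
  { n = m
  ; adj = λ i j → not ⌊ i ≟ j ⌋
  ; adj-sym = λ i j → cong not (≟-sym i j)
  ; irrefl = λ i → cong not (≟-refl i)
  }

module _ (G H : Graph) where
  private
    adj⊎ : Fin (n G) ⊎ Fin (n H) → Fin (n G) ⊎ Fin (n H) → Bool
    adj⊎ (inj₁ a) (inj₁ b) = adj G a b
    adj⊎ (inj₂ a) (inj₂ b) = adj H a b
    adj⊎ (inj₁ _) (inj₂ _) = false
    adj⊎ (inj₂ _) (inj₁ _) = false

    adj⊎-sym : ∀ x y → adj⊎ x y ≡ adj⊎ y x
    adj⊎-sym (inj₁ a) (inj₁ b) = Graph.adj-sym G a b
    adj⊎-sym (inj₂ a) (inj₂ b) = Graph.adj-sym H a b
    adj⊎-sym (inj₁ _) (inj₂ _) = refl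
    adj⊎-sym (inj₂ _) (inj₁ _) = refl

    adj⊎-irr : ∀ x → adj⊎ x x ≡ false
    adj⊎-irr (inj₁ a) = irrefl G a
    adj⊎-irr (inj₂ a) = irrefl H a

  infixr 5 _∪_
  _∪_ : Graph
  _∪_ = record
    { n = n G + n H
    ; adj = λ i j → adj⊎ (splitAt (n G) i) (splitAt (n G) j)
    ; adj-sym = λ i j → adj⊎-sym (splitAt (n G) i) (splitAt (n G) j)
    ; irrefl = λ i → adj⊎-irr (splitAt (n G) i)
    }

K0 : Graph
K0 = K 0

infix 6 _⊙_
_⊙_ : ℕ → Graph → Graph
zero  ⊙ G = K0
suc k ⊙ G = G ∪ (k ⊙ G)

_≅_ : Graph → Graph → Set
G ≅ H = Σ (Fin (n G) ↔ Fin (n H)) λ f →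
  ∀ i j → adj G i j ≡ adj H (Inverse.to f i) (Inverse.to f j)

Independent : (G : Graph) → Subset (n G) → Set
Independent G S = ∀ i j → i ∈ S → j ∈ S → adj G i j ≡ false

Maximal : (G : Graph) → Subset (n G) → Set
Maximal G S = ∀ T → Independent G T → S ⊆ T → T ⊆ S

IsMIS : (G : Graph) → Subset (n G) → Set
IsMIS G S = Independent G S × Maximal G S

independent? : (G : Graph) → ∀ S → Dec (Independent G S)
independent? G S =
  all? λ i → all? λ j → (i ∈? S) →-dec ((j ∈? S) →-dec (adj G i j ≟ᵇ false))

maximal? : (G : Graph) → ∀ S → Dec (Maximal G S)
maximal? G S with anySubset? {P = λ T → Independent G T × S ⊆ T × ¬ (T ⊆ S)}
                    (λ T → independent? G T ×-dec ((S ⊆? T) ×-dec ¬? (T ⊆? S)))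
... | yes (T , iT , S⊆T , T⊈S) = no λ m → T⊈S (m T iT S⊆T)
... | no ¬∃ = yes λ T iT S⊆T →
        decidable-stable (T ⊆? S) (λ T⊈S → ¬∃ (T , iT , S⊆T , T⊈S))

isMIS? : (G : Graph) → ∀ S → Dec (IsMIS G S)
isMIS? G S = independent? G S ×-dec maximal? G S

allSubsets : (m : ℕ) → List (Subset m)
allSubsets zero    = [] ∷ []
allSubsets (suc m) = map (inside ∷_) (allSubsets m) ++ map (outside ∷_) (allSubsets m)

mis : Graph → ℕ
mis G = length (filter (isMIS? G) (allSubsets (n G)))

-- a matching: a list of edges whose endpoints are pairwise distinct
-- (so the edges are pairwise disjoint, and in particular distinct)
endpoints : ∀ {m} → List (Fin m × Fin m) → List (Fin m)
endpoints [] = []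
endpoints ((a , b) ∷ es) = a ∷ b ∷ endpoints es

IsMatching : (G : Graph) → List (Fin (n G) × Fin (n G)) → Set
IsMatching G M = All (λ e → adj G (proj₁ e) (proj₂ e) ≡ true) M × Unique (endpoints M)

MatchingNumber : Graph → ℕ → Set
MatchingNumber G t =
  (Σ _ λ M → IsMatching G M × length M ≡ t) ×
  (∀ M → IsMatching G M → length M ≤ t)

-- Fix a maximum matching M with edges aᵢbᵢ (i < t). Its endpoints cover every edge,
-- so a maximal independent set S is determined by its matched vertices, and S
-- contains at most one endpoint of each edge; recording which one (or neither) maps
-- the maximal independent sets injectively into {0,1,2}ᵗ, so mis G ≤ 3ᵗ.
--
-- If equality holds, every pattern is realised. The pattern avoiding all endpoints
-- gives an unmatched neighbour xᵢ of aᵢ; since M has no augmenting path xᵢaᵢbᵢy,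
-- xᵢ is the only unmatched neighbour of aᵢ and of bᵢ. Patterns prescribing two
-- endpoints show that distinct matching edges are not joined, and the pattern
-- prescribing aᵢ alone separates xᵢ from xⱼ. So G consists of the triangles aᵢbᵢxᵢ
-- and isolated vertices. Conversely, in tK₃ ∪ rK₁ choosing one corner of every
-- triangle together with all isolated vertices gives 3ᵗ maximal independent sets.

module Submission where

open import Defs
open import Data.Bool using (Bool; true; false; not; _∧_)
open import Data.Bool.Properties using (¬-not) renaming (_≟_ to _≟ᵇ_)
open import Data.Empty using (⊥; ⊥-elim)
open import Data.Fin using (Fin; zero; suc; _≟_; _↑ˡ_; _↑ʳ_; splitAt; join; inject₁)
open import Data.Fin.Patterns using (0F; 1F; 2F)
open import Data.Fin.Properties
  using (any?; all?; injective⇒≤; punchOut-injective; splitAt-↑ˡ; splitAt-↑ʳ; join-splitAt;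
         ↑ˡ-injective; ↑ʳ-injective; +↔⊎)
open import Data.Fin.Subset using (Subset; _∈_; _∉_; _⊆_; ⁅_⁆; inside; outside) renaming (_∪_ to _∪ₛ_)
open import Data.Fin.Subset.Properties using (_∈?_; p⊆p∪q; x∈p∪q⁺; x∈p∪q⁻; x∈⁅x⁆; x∈⁅y⁆⇒x≡y; ⊆-antisym)
open import Data.List as List
  using (List; []; _∷_; _++_; length; cartesianProductWith; filter; map; removeAt; allFin)
open import Data.List.Properties using (length-++; length-map; ++-identityʳ; length-removeAt′)
open import Data.List.Membership.Propositional using () renaming (_∈_ to _∈ₗ_)
open import Data.List.Membership.Propositional.Properties
  using (∈-lookup; ∈-cartesianProductWith⁺; ∈-filter⁺; ∈-filter⁻; ∈-allFin)
open import Data.List.Relation.Binary.Permutation.Propositional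
  using (_↭_; ↭-refl; ↭-prep; ↭-trans; ↭-sym; ↭⇒↭ₛ)
open import Data.List.Relation.Binary.Permutation.Propositional.Properties using (shifts; ∈-resp-↭)
import Data.List.Relation.Binary.Permutation.Setoid.Properties as Permutationₛ
open import Data.List.Relation.Unary.All as All using (All; []; _∷_)
open import Data.List.Relation.Unary.All.Properties using (¬Any⇒All¬; All¬⇒¬Any)
open import Data.List.Relation.Unary.AllPairs using ([]; _∷_)
open import Data.List.Relation.Unary.Any as Any using (here; there; index)
open import Data.List.Relation.Unary.Any.Properties using (lookup-index)
open import Data.List.Relation.Unary.Unique.Propositional using (Unique)
import Data.List.Relation.Unary.Unique.Propositional.Properties as Unique
open import Data.Nat using (ℕ; zero; suc; _+_; _*_; _^_; _≤_)
open import Data.Nat.Properties using (<-irrefl; ≤-trans; ≤-reflexive; ≤-antisym; 1+n≰n; +-identityʳ)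
open import Data.Product using (∃; ∃₂; _×_; _,_; proj₁; proj₂)
open import Data.Sum using (_⊎_; inj₁; inj₂)
import Data.Sum as Sum
open import Data.Sum.Function.Propositional using (_⊎-↔_)
open import Data.Vec using (Vec; []; _∷_; lookup; tabulate; replicate; _[_]≔_)
open import Data.Vec.Properties
  using (∷-injective; lookup∘tabulate; tabulate∘lookup; tabulate-cong; []=⇒lookup; lookup⇒[]=;
         lookup-replicate; lookup∘update; lookup∘update′)
open import Function using (_∘_)
open import Function.Bundles using (_↔_; _⇔_; Inverse; mk↔ₛ′; mk⇔; mk⤖)
open import Function.Consequences.Propositional using (strictlySurjective⇒surjective)
open import Function.Definitions using (Injective; StrictlySurjective)
open import Function.Properties.Bijection using (⤖⇒↔)
open import Function.Properties.Inverse using (↔-sym; ↔-trans)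
open import Relation.Binary.PropositionalEquality
  using (_≡_; _≢_; refl; sym; trans; cong; cong₂; subst; module ≡-Reasoning)
open import Relation.Binary.PropositionalEquality.Properties using (setoid)
open import Relation.Nullary using (Dec; yes; no; ¬_; ¬?; contradiction)
open import Relation.Nullary.Decidable using (⌊_⌋; _×-dec_; isYes≗does; dec-false)

private
  variable
    A B : Set

-- Counting by injections between duplicate-free lists

injective⇒strictlySurjective : ∀ {m n} {f : Fin m → Fin n} →
  Injective _≡_ _≡_ f → n ≤ m → StrictlySurjective _≡_ f
injective⇒strictlySurjective {m} {suc n} {f} f-inj n≤m y with any? (λ x → f x ≟ y)
... | yes hit = hit
... | no miss = ⊥-elim (<-irrefl refl (≤-trans n≤m m≤n))
  where
  m≤n : m ≤ n
  m≤n = injective⇒≤ (λ {x} {x′} eq →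
          f-inj (punchOut-injective (miss ∘ (x ,_) ∘ sym) (miss ∘ (x′ ,_) ∘ sym) eq))

Unique⇒lookup-injective : {xs : List A} → Unique xs → Injective _≡_ _≡_ (List.lookup xs)
Unique⇒lookup-injective {xs = x ∷ xs} (x∉ ∷ xs!) {zero}  {zero}  _  = refl
Unique⇒lookup-injective {xs = x ∷ xs} (x∉ ∷ xs!) {zero}  {suc j} eq = ⊥-elim (All.lookup x∉ (∈-lookup j) eq)
Unique⇒lookup-injective {xs = x ∷ xs} (x∉ ∷ xs!) {suc i} {zero}  eq = ⊥-elim (All.lookup x∉ (∈-lookup i) (sym eq))
Unique⇒lookup-injective {xs = x ∷ xs} (x∉ ∷ xs!) {suc i} {suc j} eq = cong suc (Unique⇒lookup-injective xs! eq)

module _ {xs : List A} {ys : List B} (f : A → B) (xs! : Unique xs)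
         (f-into : ∀ {x} → x ∈ₗ xs → f x ∈ₗ ys)
         (f-inj : ∀ {x x′} → x ∈ₗ xs → x′ ∈ₗ xs → f x ≡ f x′ → x ≡ x′) where

  private
    onIndices : Fin (length xs) → Fin (length ys)
    onIndices i = index (f-into (∈-lookup i))

    onIndices-lookup : ∀ i → f (List.lookup xs i) ≡ List.lookup ys (onIndices i)
    onIndices-lookup i = lookup-index (f-into (∈-lookup i))

    onIndices-injective : Injective _≡_ _≡_ onIndices
    onIndices-injective {i} {j} eq = Unique⇒lookup-injective xs!
      (f-inj (∈-lookup i) (∈-lookup j)
        (trans (onIndices-lookup i) (trans (cong (List.lookup ys) eq) (sym (onIndices-lookup j)))))

  injection⇒length≤ : length xs ≤ length ys
  injection⇒length≤ = injective⇒≤ onIndices-injective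

  injection⇒onto : length ys ≤ length xs → ∀ {y} → y ∈ₗ ys → ∃ λ x → x ∈ₗ xs × f x ≡ y
  injection⇒onto ys≤xs y∈ys with i , i↦y ← injective⇒strictlySurjective onIndices-injective ys≤xs (index y∈ys) =
    List.lookup xs i , ∈-lookup i ,
    trans (onIndices-lookup i) (trans (cong (List.lookup ys) i↦y) (sym (lookup-index y∈ys)))

Unique-resp-↭ : ∀ {xs ys : List A} → xs ↭ ys → Unique xs → Unique ys
Unique-resp-↭ {A = A} p = Permutationₛ.Unique-resp-↭ (setoid A) (↭⇒↭ₛ p)

vectors : List A → (k : ℕ) → List (Vec A k)
vectors xs zero    = [] ∷ []
vectors xs (suc k) = cartesianProductWith _∷_ xs (vectors xs k)

length-cartesianProductWith : ∀ {C : Set} (g : A → B → C) xs ys →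
  length (cartesianProductWith g xs ys) ≡ length xs * length ys
length-cartesianProductWith g []       ys = refl
length-cartesianProductWith g (x ∷ xs) ys = trans (length-++ (map (g x) ys))
  (cong₂ _+_ (length-map (g x) ys) (length-cartesianProductWith g xs ys))

length-vectors : ∀ (xs : List A) k → length (vectors xs k) ≡ length xs ^ k
length-vectors xs zero    = refl
length-vectors xs (suc k) = trans (length-cartesianProductWith _∷_ xs (vectors xs k))
  (cong (length xs *_) (length-vectors xs k))

∈-vectors : ∀ {xs : List A} → (∀ x → x ∈ₗ xs) → ∀ {k} (v : Vec A k) → v ∈ₗ vectors xs k
∈-vectors all∈ []       = here refl
∈-vectors all∈ (x ∷ v) = ∈-cartesianProductWith⁺ _∷_ (all∈ x) (∈-vectors all∈ v)

vectors-unique : ∀ {xs : List A} → Unique xs → ∀ k → Unique (vectors xs k)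
vectors-unique xs! zero    = [] ∷ []
vectors-unique xs! (suc k) = Unique.cartesianProductWith⁺ _∷_ ∷-injective xs! (vectors-unique xs! k)

⌊≟⌋-true : ∀ {m} {i j : Fin m} → ⌊ i ≟ j ⌋ ≡ true → i ≡ j
⌊≟⌋-true {i = i} {j} eq with i ≟ j
... | yes i≡j = i≡j

⌊≟⌋-false : ∀ {m} {i j : Fin m} → i ≢ j → ⌊ i ≟ j ⌋ ≡ false
⌊≟⌋-false {i = i} {j} i≢j = trans (isYes≗does (i ≟ j)) (dec-false (i ≟ j) i≢j)

⌊≟⌋-injective : ∀ {m k} (f : Fin m → Fin k) → Injective _≡_ _≡_ f → ∀ i j → ⌊ f i ≟ f j ⌋ ≡ ⌊ i ≟ j ⌋
⌊≟⌋-injective f f-inj i j with i ≟ j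
... | yes refl = ≟-refl (f i)
... | no  i≢j  = ⌊≟⌋-false (i≢j ∘ f-inj)

↑ˡ≢↑ʳ : ∀ {m} n (i : Fin m) (j : Fin n) → i ↑ˡ n ≢ m ↑ʳ j
↑ˡ≢↑ʳ {m} n i j eq with () ← trans (sym (splitAt-↑ˡ m i n)) (trans (cong (splitAt m) eq) (splitAt-↑ʳ m n j))

lookup-ext : ∀ {k} {p q : Vec A k} → (∀ i → lookup p i ≡ lookup q i) → p ≡ q
lookup-ext {p = p} {q} p≗q = trans (sym (tabulate∘lookup p)) (trans (tabulate-cong p≗q) (tabulate∘lookup q))

tabulate-injective : ∀ {k} {f g : Fin k → A} → tabulate f ≡ tabulate g → ∀ i → f i ≡ g i
tabulate-injective {f = f} {g} eq i =
  trans (sym (lookup∘tabulate f i)) (trans (cong (λ v → lookup v i) eq) (lookup∘tabulate g i))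

∈-tabulate⁺ : ∀ {m} {f : Fin m → Bool} {v} → f v ≡ true → v ∈ tabulate f
∈-tabulate⁺ {f = f} {v} fv = lookup⇒[]= v (tabulate f) (trans (lookup∘tabulate f v) fv)

∈-tabulate⁻ : ∀ {m} {f : Fin m → Bool} {v} → v ∈ tabulate f → f v ≡ true
∈-tabulate⁻ {f = f} {v} v∈ = trans (sym (lookup∘tabulate f v)) ([]=⇒lookup v∈)

-- Maximal independent sets

allSubsets≡vectors : ∀ m → allSubsets m ≡ vectors (inside ∷ outside ∷ []) m
allSubsets≡vectors zero    = refl
allSubsets≡vectors (suc m) rewrite allSubsets≡vectors m =
  cong (map (inside ∷_) subsets ++_) (sym (++-identityʳ (map (outside ∷_) subsets)))
  where
  subsets : List (Subset m)
  subsets = vectors (inside ∷ outside ∷ []) m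

misList : (G : Graph) → List (Subset (n G))
misList G = filter (isMIS? G) (allSubsets (n G))

module _ (G : Graph) where

  misList-unique : Unique (misList G)
  misList-unique = Unique.filter⁺ (isMIS? G)
    (subst Unique (sym (allSubsets≡vectors (n G))) (vectors-unique sides-unique (n G)))
    where
    sides-unique : Unique (inside ∷ outside ∷ [])
    sides-unique = ((λ ()) ∷ []) ∷ [] ∷ []

  ∈-misList⁺ : ∀ {S} → IsMIS G S → S ∈ₗ misList G
  ∈-misList⁺ {S} = ∈-filter⁺ (isMIS? G) (subst (S ∈ₗ_) (sym (allSubsets≡vectors (n G)))
    (∈-vectors all-sides S))
    where
    all-sides : ∀ b → b ∈ₗ inside ∷ outside ∷ []
    all-sides true  = here refl
    all-sides false = there (here refl)

  ∈-misList⁻ : ∀ {S} → S ∈ₗ misList G → IsMIS G S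
  ∈-misList⁻ = proj₂ ∘ ∈-filter⁻ (isMIS? G) {xs = allSubsets (n G)}

  MIS-dominates : ∀ {S} → IsMIS G S → ∀ {v} → v ∉ S → ∃ λ u → u ∈ S × adj G v u ≡ true
  MIS-dominates {S} (S-ind , S-max) {v} v∉S
    with any? (λ u → (u ∈? S) ×-dec (adj G v u ≟ᵇ true))
  ... | yes found = found
  ... | no none = contradiction (S-max (S ∪ₛ ⁅ v ⁆) S+v-ind (p⊆p∪q _) (x∈p∪q⁺ (inj₂ (x∈⁅x⁆ v)))) v∉S
    where
    v≁S : ∀ {u} → u ∈ S → adj G v u ≡ false
    v≁S u∈S = ¬-not (λ v~u → none (_ , u∈S , v~u))

    S+v-ind : Independent G (S ∪ₛ ⁅ v ⁆)
    S+v-ind i j i∈ j∈ with x∈p∪q⁻ S ⁅ v ⁆ i∈ | x∈p∪q⁻ S ⁅ v ⁆ j∈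
    ... | inj₁ i∈S | inj₁ j∈S = S-ind i j i∈S j∈S
    ... | inj₁ i∈S | inj₂ j∈v rewrite x∈⁅y⁆⇒x≡y v j∈v = trans (adj-sym G i v) (v≁S i∈S)
    ... | inj₂ i∈v | inj₁ j∈S rewrite x∈⁅y⁆⇒x≡y v i∈v = v≁S j∈S
    ... | inj₂ i∈v | inj₂ j∈v rewrite x∈⁅y⁆⇒x≡y v i∈v | x∈⁅y⁆⇒x≡y v j∈v = irrefl G v

  VertexCover : (Fin (n G) → Set) → Set
  VertexCover C = ∀ u v → adj G u v ≡ true → C u ⊎ C v

  MIS-⊆-if-agree-on-cover : ∀ {C S T} → VertexCover C → Independent G S → IsMIS G T →
    (∀ {v} → C v → v ∈ S → v ∈ T) → (∀ {v} → C v → v ∈ T → v ∈ S) → S ⊆ T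
  MIS-⊆-if-agree-on-cover {T = T} cover S-ind T-mis S→T T→S {v} v∈S with v ∈? T
  ... | yes v∈T = v∈T
  ... | no v∉T with u , u∈T , v~u ← MIS-dominates T-mis v∉T with cover v u v~u
  ...   | inj₁ v∈C = contradiction (S→T v∈C v∈S) v∉T
  ...   | inj₂ u∈C = contradiction (trans (sym v~u) (S-ind v u v∈S (T→S u∈C u∈T))) λ ()

  MIS-≡-if-agree-on-cover : ∀ {C S T} → VertexCover C → IsMIS G S → IsMIS G T →
    (∀ {v} → C v → v ∈ S → v ∈ T) → (∀ {v} → C v → v ∈ T → v ∈ S) → S ≡ T
  MIS-≡-if-agree-on-cover cover S-mis T-mis S→T T→S = ⊆-antisym
    (MIS-⊆-if-agree-on-cover cover (proj₁ S-mis) T-mis S→T T→S)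
    (MIS-⊆-if-agree-on-cover cover (proj₁ T-mis) S-mis T→S S→T)

-- Labelled copies of tK₃ ∪ rK₁

-- inj₁ (i , k) is corner k of the i-th triangle, inj₂ j the j-th isolated vertex.
Label : ℕ → ℕ → Set
Label t r = (Fin t × Fin 3) ⊎ Fin r

label-adj : ∀ {t r} → Label t r → Label t r → Bool
label-adj (inj₁ (i , k)) (inj₁ (j , l)) = ⌊ i ≟ j ⌋ ∧ not ⌊ k ≟ l ⌋
label-adj (inj₁ _)       (inj₂ _)       = false
label-adj (inj₂ _)       _              = false

label-adj-triangle : ∀ {t r} i {k l} → k ≢ l → label-adj {t} {r} (inj₁ (i , k)) (inj₁ (i , l)) ≡ true
label-adj-triangle i k≢l rewrite ≟-refl i | ⌊≟⌋-false k≢l = refl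

record Labelling (G : Graph) (t r : ℕ) : Set where
  field
    vertex     : Label t r ↔ Fin (n G)
    adj-vertex : ∀ x y → adj G (Inverse.to vertex x) (Inverse.to vertex y) ≡ label-adj x y

  open Inverse vertex public using (to; from; strictlyInverseˡ; strictlyInverseʳ)

  adj-label : ∀ u v → adj G u v ≡ label-adj (from u) (from v)
  adj-label u v = trans (cong₂ (adj G) (sym (strictlyInverseˡ u)) (sym (strictlyInverseˡ v)))
                        (adj-vertex (from u) (from v))

labellings⇒≅ : ∀ {G H t r} → Labelling G t r → Labelling H t r → G ≅ H
labellings⇒≅ LG LH = ↔-trans (↔-sym (vertex LG)) (vertex LH) ,
  λ u v → trans (adj-label LG u v) (sym (adj-vertex LH (from LG u) (from LG v)))
  where open Labelling

≅-labelling : ∀ {G H t r} → G ≅ H → Labelling H t r → Labelling G t r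
≅-labelling {G} {H} (f , f-adj) LH = record
  { vertex     = ↔-trans (vertex LH) (↔-sym f)
  ; adj-vertex = λ x y → begin
      adj G (F.from (to LH x)) (F.from (to LH y))
        ≡⟨ f-adj _ _ ⟩
      adj H (F.to (F.from (to LH x))) (F.to (F.from (to LH y)))
        ≡⟨ cong₂ (adj H) (F.strictlyInverseˡ _) (F.strictlyInverseˡ _) ⟩
      adj H (to LH x) (to LH y)
        ≡⟨ adj-vertex LH x y ⟩
      label-adj x y ∎
  }
  where
  open Labelling
  module F = Inverse f
  open ≡-Reasoning

¬Label-0-0 : ¬ Label 0 0
¬Label-0-0 (inj₁ (() , _))
¬Label-0-0 (inj₂ ())

K0-labelling : Labelling K0 0 0
K0-labelling = record
  { vertex     = mk↔ₛ′ (⊥-elim ∘ ¬Label-0-0) (λ ()) (λ ()) (⊥-elim ∘ ¬Label-0-0)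
  ; adj-vertex = λ x → ⊥-elim (¬Label-0-0 x)
  }

K3-labelling : Labelling (K 3) 1 0
K3-labelling = record
  { vertex     = mk↔ₛ′ corner (λ k → inj₁ (zero , k)) (λ _ → refl) corner-label
  ; adj-vertex = adj-corner
  }
  where
  corner : Label 1 0 → Fin 3
  corner (inj₁ (zero , k)) = k

  corner-label : ∀ x → inj₁ (zero , corner x) ≡ x
  corner-label (inj₁ (zero , k)) = refl

  adj-corner : ∀ x y → adj (K 3) (corner x) (corner y) ≡ label-adj x y
  adj-corner (inj₁ (zero , k)) (inj₁ (zero , l)) = refl

K1-labelling : Labelling (K 1) 0 1
K1-labelling = record
  { vertex     = mk↔ₛ′ point inj₂ (λ _ → refl) point-label
  ; adj-vertex = adj-point
  }
  where
  point : Label 0 1 → Fin 1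
  point (inj₂ j) = j

  point-label : ∀ x → inj₂ (point x) ≡ x
  point-label (inj₂ j) = refl

  adj-point : ∀ x y → adj (K 1) (point x) (point y) ≡ label-adj x y
  adj-point (inj₂ zero) (inj₂ zero) = refl

sumAdj : ∀ {A B : Set} → (A → A → Bool) → (B → B → Bool) → A ⊎ B → A ⊎ B → Bool
sumAdj f g (inj₁ a) (inj₁ a′) = f a a′
sumAdj f g (inj₂ b) (inj₂ b′) = g b b′
sumAdj f g (inj₁ _) (inj₂ _)  = false
sumAdj f g (inj₂ _) (inj₁ _)  = false

adj-∪ : ∀ G H x y → adj (G ∪ H) (join (n G) (n H) x) (join (n G) (n H) y) ≡ sumAdj (adj G) (adj H) x y
adj-∪ G H (inj₁ u) (inj₁ v) rewrite splitAt-↑ˡ (n G) u (n H) | splitAt-↑ˡ (n G) v (n H) = refl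
adj-∪ G H (inj₁ u) (inj₂ v) rewrite splitAt-↑ˡ (n G) u (n H) | splitAt-↑ʳ (n G) (n H) v = refl
adj-∪ G H (inj₂ u) (inj₁ v) rewrite splitAt-↑ʳ (n G) (n H) u | splitAt-↑ˡ (n G) v (n H) = refl
adj-∪ G H (inj₂ u) (inj₂ v) rewrite splitAt-↑ʳ (n G) (n H) u | splitAt-↑ʳ (n G) (n H) v = refl

module _ {t₁ r₁ t₂ r₂ : ℕ} where

  joinLabel : Label t₁ r₁ ⊎ Label t₂ r₂ → Label (t₁ + t₂) (r₁ + r₂)
  joinLabel (inj₁ (inj₁ (i , k))) = inj₁ (i ↑ˡ t₂ , k)
  joinLabel (inj₁ (inj₂ j))       = inj₂ (j ↑ˡ r₂)
  joinLabel (inj₂ (inj₁ (i , k))) = inj₁ (t₁ ↑ʳ i , k)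
  joinLabel (inj₂ (inj₂ j))       = inj₂ (r₁ ↑ʳ j)

  splitLabel : Label (t₁ + t₂) (r₁ + r₂) → Label t₁ r₁ ⊎ Label t₂ r₂
  splitLabel (inj₁ (i , k)) = Sum.map (λ i₁ → inj₁ (i₁ , k)) (λ i₂ → inj₁ (i₂ , k)) (splitAt t₁ i)
  splitLabel (inj₂ j)       = Sum.map inj₂ inj₂ (splitAt r₁ j)

  splitLabel-joinLabel : ∀ z → splitLabel (joinLabel z) ≡ z
  splitLabel-joinLabel (inj₁ (inj₁ (i , k))) rewrite splitAt-↑ˡ t₁ i t₂ = refl
  splitLabel-joinLabel (inj₁ (inj₂ j))       rewrite splitAt-↑ˡ r₁ j r₂ = refl
  splitLabel-joinLabel (inj₂ (inj₁ (i , k))) rewrite splitAt-↑ʳ t₁ t₂ i = refl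
  splitLabel-joinLabel (inj₂ (inj₂ j))       rewrite splitAt-↑ʳ r₁ r₂ j = refl

  joinLabel-splitLabel : ∀ x → joinLabel (splitLabel x) ≡ x
  joinLabel-splitLabel (inj₁ (i , k)) with splitAt t₁ i | join-splitAt t₁ t₂ i
  ... | inj₁ i₁ | eq = cong (λ i → inj₁ (i , k)) eq
  ... | inj₂ i₂ | eq = cong (λ i → inj₁ (i , k)) eq
  joinLabel-splitLabel (inj₂ j) with splitAt r₁ j | join-splitAt r₁ r₂ j
  ... | inj₁ j₁ | eq = cong inj₂ eq
  ... | inj₂ j₂ | eq = cong inj₂ eq

  label-+↔⊎ : Label (t₁ + t₂) (r₁ + r₂) ↔ (Label t₁ r₁ ⊎ Label t₂ r₂)
  label-+↔⊎ = mk↔ₛ′ splitLabel joinLabel splitLabel-joinLabel joinLabel-splitLabel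

  label-adj-joinLabel : ∀ z w → label-adj (joinLabel z) (joinLabel w) ≡ sumAdj label-adj label-adj z w
  label-adj-joinLabel (inj₁ (inj₁ (i , k))) (inj₁ (inj₁ (j , l))) =
    cong (_∧ not ⌊ k ≟ l ⌋) (⌊≟⌋-injective (_↑ˡ t₂) (↑ˡ-injective t₂ _ _) i j)
  label-adj-joinLabel (inj₁ (inj₁ (i , k))) (inj₂ (inj₁ (j , l))) =
    cong (_∧ not ⌊ k ≟ l ⌋) (⌊≟⌋-false (↑ˡ≢↑ʳ t₂ i j))
  label-adj-joinLabel (inj₂ (inj₁ (i , k))) (inj₁ (inj₁ (j , l))) =
    cong (_∧ not ⌊ k ≟ l ⌋) (⌊≟⌋-false (↑ˡ≢↑ʳ t₂ j i ∘ sym))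
  label-adj-joinLabel (inj₂ (inj₁ (i , k))) (inj₂ (inj₁ (j , l))) =
    cong (_∧ not ⌊ k ≟ l ⌋) (⌊≟⌋-injective (t₁ ↑ʳ_) (↑ʳ-injective t₁ _ _) i j)
  label-adj-joinLabel (inj₁ (inj₁ _)) (inj₁ (inj₂ _)) = refl
  label-adj-joinLabel (inj₁ (inj₁ _)) (inj₂ (inj₂ _)) = refl
  label-adj-joinLabel (inj₂ (inj₁ _)) (inj₁ (inj₂ _)) = refl
  label-adj-joinLabel (inj₂ (inj₁ _)) (inj₂ (inj₂ _)) = refl
  label-adj-joinLabel (inj₁ (inj₂ _)) (inj₁ _)        = refl
  label-adj-joinLabel (inj₁ (inj₂ _)) (inj₂ _)        = refl
  label-adj-joinLabel (inj₂ (inj₂ _)) (inj₁ _)        = refl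
  label-adj-joinLabel (inj₂ (inj₂ _)) (inj₂ _)        = refl

∪-labelling : ∀ {G H t₁ r₁ t₂ r₂} → Labelling G t₁ r₁ → Labelling H t₂ r₂ →
  Labelling (G ∪ H) (t₁ + t₂) (r₁ + r₂)
∪-labelling {G} {H} {t₁} {r₁} {t₂} {r₂} LG LH = record
  { vertex     = ↔-trans label-split (↔-trans (vertex LG ⊎-↔ vertex LH) (↔-sym +↔⊎))
  ; adj-vertex = λ x y → begin
      adj (G ∪ H) (join (n G) (n H) (toSum (split x))) (join (n G) (n H) (toSum (split y)))
        ≡⟨ adj-∪ G H (toSum (split x)) (toSum (split y)) ⟩
      sumAdj (adj G) (adj H) (toSum (split x)) (toSum (split y))
        ≡⟨ sumAdj-toSum (split x) (split y) ⟩
      sumAdj label-adj label-adj (split x) (split y)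
        ≡⟨ sym (label-adj-joinLabel {t₁} {r₁} {t₂} {r₂} (split x) (split y)) ⟩
      label-adj (Split.from (split x)) (Split.from (split y))
        ≡⟨ cong₂ label-adj (Split.strictlyInverseʳ x) (Split.strictlyInverseʳ y) ⟩
      label-adj x y ∎
  }
  where
  open Labelling
  open ≡-Reasoning

  label-split : Label (t₁ + t₂) (r₁ + r₂) ↔ (Label t₁ r₁ ⊎ Label t₂ r₂)
  label-split = label-+↔⊎

  module Split = Inverse label-split

  split : Label (t₁ + t₂) (r₁ + r₂) → Label t₁ r₁ ⊎ Label t₂ r₂
  split = Split.to

  toSum : Label t₁ r₁ ⊎ Label t₂ r₂ → Fin (n G) ⊎ Fin (n H)
  toSum = Sum.map (to LG) (to LH)

  sumAdj-toSum : ∀ z w → sumAdj (adj G) (adj H) (toSum z) (toSum w) ≡ sumAdj label-adj label-adj z w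
  sumAdj-toSum (inj₁ x) (inj₁ y) = adj-vertex LG x y
  sumAdj-toSum (inj₁ x) (inj₂ y) = refl
  sumAdj-toSum (inj₂ x) (inj₁ y) = refl
  sumAdj-toSum (inj₂ x) (inj₂ y) = adj-vertex LH x y

⊙K3-labelling : ∀ t → Labelling (t ⊙ K 3) t 0
⊙K3-labelling zero    = K0-labelling
⊙K3-labelling (suc t) = ∪-labelling K3-labelling (⊙K3-labelling t)

⊙K1-labelling : ∀ r → Labelling (r ⊙ K 1) 0 r
⊙K1-labelling zero    = K0-labelling
⊙K1-labelling (suc r) = ∪-labelling K1-labelling (⊙K1-labelling r)

triangles∪isolated-labelling : ∀ t r → Labelling ((t ⊙ K 3) ∪ (r ⊙ K 1)) t r
triangles∪isolated-labelling t r = subst (λ t′ → Labelling ((t ⊙ K 3) ∪ (r ⊙ K 1)) t′ r) (+-identityʳ t)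
  (∪-labelling (⊙K3-labelling t) (⊙K1-labelling r))

module _ {G : Graph} {t r : ℕ} (L : Labelling G t r) where
  open Labelling L

  chosen : Vec (Fin 3) t → Label t r → Bool
  chosen p (inj₁ (i , k)) = ⌊ k ≟ lookup p i ⌋
  chosen p (inj₂ _)       = true

  transversal : Vec (Fin 3) t → Subset (n G)
  transversal p = tabulate (chosen p ∘ from)

  ∈-transversal⁺ : ∀ {p} x → chosen p x ≡ true → to x ∈ transversal p
  ∈-transversal⁺ x px = ∈-tabulate⁺ (trans (cong (chosen _) (strictlyInverseʳ x)) px)

  ∈-transversal⁻ : ∀ {p} x → to x ∈ transversal p → chosen p x ≡ true
  ∈-transversal⁻ x x∈ = trans (cong (chosen _) (sym (strictlyInverseʳ x))) (∈-tabulate⁻ x∈)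

  chosen-independent : ∀ p x y → chosen p x ≡ true → chosen p y ≡ true → label-adj x y ≡ false
  chosen-independent p (inj₁ (i , k)) (inj₁ (j , l)) px py with i ≟ j
  ... | no _ = refl
  ... | yes refl rewrite ⌊≟⌋-true px | ⌊≟⌋-true py = cong not (≟-refl (lookup p i))
  chosen-independent p (inj₁ _) (inj₂ _) px py = refl
  chosen-independent p (inj₂ _) y        px py = refl

  transversal-MIS : ∀ p → IsMIS G (transversal p)
  transversal-MIS p = independent , maximal
    where
    independent : Independent G (transversal p)
    independent u v u∈ v∈ = trans (adj-label u v)
      (chosen-independent p (from u) (from v) (∈-tabulate⁻ u∈) (∈-tabulate⁻ v∈))

    maximal : Maximal G (transversal p)
    maximal T T-ind S⊆T {v} v∈T = ∈-tabulate⁺ (chosen-from (from v) refl)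
      where
      chosen-from : ∀ x → from v ≡ x → chosen p x ≡ true
      chosen-from (inj₂ _) _ = refl
      chosen-from (inj₁ (i , k)) v↦ik with k ≟ lookup p i
      ... | yes _ = refl
      ... | no k≢pᵢ = contradiction (trans (sym v~w) (T-ind v w v∈T (S⊆T w∈S))) λ ()
        where
        w : Fin (n G)
        w = to (inj₁ (i , lookup p i))

        v~w : adj G v w ≡ true
        v~w = trans (adj-label v w) (trans (cong₂ label-adj v↦ik (strictlyInverseʳ _))
                (label-adj-triangle {t} {r} i k≢pᵢ))

        w∈S : w ∈ transversal p
        w∈S = ∈-transversal⁺ (inj₁ (i , lookup p i)) (≟-refl (lookup p i))

  transversal-injective : ∀ {p q} → transversal p ≡ transversal q → p ≡ q
  transversal-injective {p} {q} eq = lookup-ext λ i → ⌊≟⌋-true (∈-transversal⁻ (inj₁ (i , lookup p i))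
    (subst (to (inj₁ (i , lookup p i)) ∈_) eq (∈-transversal⁺ (inj₁ (i , lookup p i)) (≟-refl (lookup p i)))))

  3^t≤mis : 3 ^ t ≤ mis G
  3^t≤mis = subst (_≤ mis G) (length-vectors (allFin 3) t)
    (injection⇒length≤ transversal (vectors-unique (Unique.allFin⁺ 3) t)
      (λ {p} _ → ∈-misList⁺ G (transversal-MIS p)) (λ _ _ → transversal-injective))
-- Maximum matchings

module _ {m : ℕ} where

  private
    end : Fin 2 → Fin m × Fin m → Fin m
    end 0F = proj₁
    end 1F = proj₂

  endpoint : (M : List (Fin m × Fin m)) → Fin (length M) → Fin 2 → Fin m
  endpoint M i s = end s (List.lookup M i)

  ∈-endpoints : ∀ M i s → endpoint M i s ∈ₗ endpoints M
  ∈-endpoints (_ ∷ M) zero    0F = here refl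
  ∈-endpoints (_ ∷ M) zero    1F = there (here refl)
  ∈-endpoints (_ ∷ M) (suc i) s  = there (there (∈-endpoints M i s))

  ∈-endpoints⁻ : ∀ M {v} → v ∈ₗ endpoints M → ∃₂ λ i s → endpoint M i s ≡ v
  ∈-endpoints⁻ (_ ∷ M) (here v≡u)         = zero , 0F , sym v≡u
  ∈-endpoints⁻ (_ ∷ M) (there (here v≡w)) = zero , 1F , sym v≡w
  ∈-endpoints⁻ (_ ∷ M) (there (there v∈)) with i , s , eq ← ∈-endpoints⁻ M v∈ = suc i , s , eq

  endpoint-injective : ∀ M → Unique (endpoints M) → ∀ {i j s s′} →
    endpoint M i s ≡ endpoint M j s′ → i ≡ j × s ≡ s′
  endpoint-injective (_ ∷ M) (u∉ ∷ v∉ ∷ E!) {zero} {zero} {0F} {0F} eq = refl , refl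
  endpoint-injective (_ ∷ M) (u∉ ∷ v∉ ∷ E!) {zero} {zero} {0F} {1F} eq = contradiction eq (All.head u∉)
  endpoint-injective (_ ∷ M) (u∉ ∷ v∉ ∷ E!) {zero} {zero} {1F} {0F} eq = contradiction (sym eq) (All.head u∉)
  endpoint-injective (_ ∷ M) (u∉ ∷ v∉ ∷ E!) {zero} {zero} {1F} {1F} eq = refl , refl
  endpoint-injective (_ ∷ M) (u∉ ∷ v∉ ∷ E!) {zero} {suc j} {0F} {s′} eq =
    contradiction (subst (_∈ₗ endpoints M) (sym eq) (∈-endpoints M j s′)) (All¬⇒¬Any (All.tail u∉))
  endpoint-injective (_ ∷ M) (u∉ ∷ v∉ ∷ E!) {zero} {suc j} {1F} {s′} eq =
    contradiction (subst (_∈ₗ endpoints M) (sym eq) (∈-endpoints M j s′)) (All¬⇒¬Any v∉)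
  endpoint-injective (_ ∷ M) (u∉ ∷ v∉ ∷ E!) {suc i} {zero} {s} {0F} eq =
    contradiction (subst (_∈ₗ endpoints M) eq (∈-endpoints M i s)) (All¬⇒¬Any (All.tail u∉))
  endpoint-injective (_ ∷ M) (u∉ ∷ v∉ ∷ E!) {suc i} {zero} {s} {1F} eq =
    contradiction (subst (_∈ₗ endpoints M) eq (∈-endpoints M i s)) (All¬⇒¬Any v∉)
  endpoint-injective (_ ∷ M) (u∉ ∷ v∉ ∷ E!) {suc i} {suc j} {s} {s′} eq
    with refl , s≡s′ ← endpoint-injective M E! {i} {j} {s} {s′} eq = refl , s≡s′

  endpoints-removeAt : ∀ M i →
    endpoints M ↭ endpoint M i 0F ∷ endpoint M i 1F ∷ endpoints (removeAt M i)
  endpoints-removeAt (_ ∷ M) zero = ↭-refl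
  endpoints-removeAt ((u , v) ∷ M) (suc i) = ↭-trans
    (↭-prep u (↭-prep v (endpoints-removeAt M i)))
    (shifts (u ∷ v ∷ []) (endpoint M i 0F ∷ endpoint M i 1F ∷ []))

  All-removeAt : ∀ {P : Fin m × Fin m → Set} M i → All P M → All P (removeAt M i)
  All-removeAt (_ ∷ M) zero    (_ ∷ pM) = pM
  All-removeAt (_ ∷ M) (suc i) (pe ∷ pM) = pe ∷ All-removeAt M i pM

module MaximumMatching (G : Graph) (M : List (Fin (n G) × Fin (n G)))
  (M-matching : IsMatching G M) (M-maximum : ∀ M′ → IsMatching G M′ → length M′ ≤ length M) where

  Matched : Fin (n G) → Set
  Matched v = v ∈ₗ endpoints M

  private
    edges : All (λ e → adj G (proj₁ e) (proj₂ e) ≡ true) M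
    edges = proj₁ M-matching

    E! : Unique (endpoints M)
    E! = proj₂ M-matching

  endpoints-adjacent : ∀ i → adj G (endpoint M i 0F) (endpoint M i 1F) ≡ true
  endpoints-adjacent i = All.lookup edges (∈-lookup i)

  unmatched-independent : ∀ {u v} → ¬ Matched u → ¬ Matched v → adj G u v ≡ false
  unmatched-independent {u} {v} u∉E v∉E = ¬-not λ u~v →
    1+n≰n (M-maximum ((u , v) ∷ M)
      ( u~v ∷ edges
      , (u≢v u~v ∷ ¬Any⇒All¬ _ u∉E) ∷ ¬Any⇒All¬ _ v∉E ∷ E!))
    where
    u≢v : adj G u v ≡ true → u ≢ v
    u≢v u~v refl = contradiction (trans (sym u~v) (irrefl G u)) λ ()

  matched? : ∀ v → Dec (Matched v)
  matched? v = Any.any? (v ≟_) (endpoints M)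

  matched-cover : VertexCover G Matched
  matched-cover u v u~v with matched? u | matched? v
  ... | yes u∈E | _       = inj₁ u∈E
  ... | no _    | yes v∈E = inj₂ v∈E
  ... | no u∉E  | no v∉E  = contradiction (trans (sym u~v) (unmatched-independent u∉E v∉E)) λ ()

  no-augmenting-path : ∀ i {x y} → ¬ Matched x → ¬ Matched y → x ≢ y →
    adj G (endpoint M i 0F) x ≡ true → adj G (endpoint M i 1F) y ≡ true → ⊥
  no-augmenting-path i {x} {y} x∉E y∉E x≢y a~x b~y =
    1+n≰n (subst (length M′ ≤_) (length-removeAt′ M i) (M-maximum M′ (M′-edges , M′-unique)))
    where
    a b : Fin (n G)
    a = endpoint M i 0F
    b = endpoint M i 1F

    R M′ : List (Fin (n G) × Fin (n G))
    R  = removeAt M i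
    M′ = (x , a) ∷ (b , y) ∷ R

    M′-edges : All (λ e → adj G (proj₁ e) (proj₂ e) ≡ true) M′
    M′-edges = trans (adj-sym G x a) a~x ∷ b~y ∷ All-removeAt M i edges

    E↭abR : endpoints M ↭ a ∷ b ∷ endpoints R
    E↭abR = endpoints-removeAt M i

    fresh : ∀ {z} → ¬ Matched z → All (z ≢_) (a ∷ b ∷ endpoints R)
    fresh z∉E = ¬Any⇒All¬ _ (z∉E ∘ ∈-resp-↭ (↭-sym E↭abR))

    M′-unique : Unique (endpoints M′)
    M′-unique with (a≢b ∷ a∉R) ∷ b∉R ∷ R! ← Unique-resp-↭ E↭abR E!
                 | x≢a ∷ x≢b ∷ x∉R ← fresh x∉E
                 | y≢a ∷ y≢b ∷ y∉R ← fresh y∉E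
      = (x≢a ∷ x≢b ∷ x≢y ∷ x∉R) ∷ (a≢b ∷ (y≢a ∘ sym) ∷ a∉R) ∷ ((y≢b ∘ sym) ∷ b∉R) ∷ y∉R ∷ R!

  -- Which endpoint of the i-th matching edge lies in S, with 2F for neither; in
  -- tK₃ ∪ rK₁ the value 2F corresponds to the third corner of the i-th triangle.
  corner : Subset (n G) → Fin (length M) → Fin 3
  corner S i with endpoint M i 0F ∈? S | endpoint M i 1F ∈? S
  ... | yes _ | _     = 0F
  ... | no _  | yes _ = 1F
  ... | no _  | no _  = 2F

  ∈⇒corner : ∀ {S} → Independent G S → ∀ i s → endpoint M i s ∈ S → corner S i ≡ inject₁ s
  ∈⇒corner {S} S-ind i s e∈S with endpoint M i 0F ∈? S | endpoint M i 1F ∈? S | s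
  ... | yes _   | _      | 0F = refl
  ... | yes a∈S | _      | 1F = contradiction (trans (sym (endpoints-adjacent i)) (S-ind _ _ a∈S e∈S)) λ ()
  ... | no a∉S  | _      | 0F = contradiction e∈S a∉S
  ... | no _    | yes _  | 1F = refl
  ... | no _    | no b∉S | 1F = contradiction e∈S b∉S

  corner⇒∈ : ∀ {S} i s → corner S i ≡ inject₁ s → endpoint M i s ∈ S
  corner⇒∈ {S} i 0F eq with endpoint M i 0F ∈? S | endpoint M i 1F ∈? S | eq
  ... | yes a∈S | _       | _  = a∈S
  ... | no _    | yes _   | ()
  ... | no _    | no _    | ()
  corner⇒∈ {S} i 1F eq with endpoint M i 0F ∈? S | endpoint M i 1F ∈? S | eq
  ... | yes _   | _       | ()
  ... | no _    | yes b∈S | _  = b∈S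
  ... | no _    | no _    | ()

  corner-2F⇒∉ : ∀ {S} i s → corner S i ≡ 2F → endpoint M i s ∉ S
  corner-2F⇒∉ {S} i s eq with endpoint M i 0F ∈? S | endpoint M i 1F ∈? S | eq
  ... | yes _   | _       | ()
  ... | no _    | yes _   | ()
  ... | no a∉S  | no b∉S  | _ with s
  ...   | 0F = a∉S
  ...   | 1F = b∉S

  corners : Subset (n G) → Vec (Fin 3) (length M)
  corners S = tabulate (corner S)

  same-corners⇒⊆-on-matched : ∀ {S T} → Independent G S → (∀ i → corner S i ≡ corner T i) →
    ∀ {v} → Matched v → v ∈ S → v ∈ T
  same-corners⇒⊆-on-matched S-ind same v∈E v∈S with i , s , refl ← ∈-endpoints⁻ M v∈E =
    corner⇒∈ i s (trans (sym (same i)) (∈⇒corner S-ind i s v∈S))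

  corners-injective : ∀ {S T} → IsMIS G S → IsMIS G T → corners S ≡ corners T → S ≡ T
  corners-injective {S} {T} S-mis T-mis eq = MIS-≡-if-agree-on-cover G matched-cover S-mis T-mis
    (same-corners⇒⊆-on-matched (proj₁ S-mis) same)
    (same-corners⇒⊆-on-matched (proj₁ T-mis) (sym ∘ same))
    where
    same : ∀ i → corner S i ≡ corner T i
    same = tabulate-injective eq

  private
    |patterns| : length (vectors (allFin 3) (length M)) ≡ 3 ^ length M
    |patterns| = length-vectors (allFin 3) (length M)

    corners-into : ∀ {S} → S ∈ₗ misList G → corners S ∈ₗ vectors (allFin 3) (length M)
    corners-into {S} _ = ∈-vectors ∈-allFin (corners S)

    corners-injectiveOn : ∀ {S T} → S ∈ₗ misList G → T ∈ₗ misList G → corners S ≡ corners T → S ≡ T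
    corners-injectiveOn S∈ T∈ = corners-injective (∈-misList⁻ G S∈) (∈-misList⁻ G T∈)

  Realisable : Vec (Fin 3) (length M) → Set
  Realisable p = ∃ λ S → IsMIS G S × ∀ i → corner S i ≡ lookup p i

  mis≤3^|M| : mis G ≤ 3 ^ length M
  mis≤3^|M| = subst (mis G ≤_) |patterns|
    (injection⇒length≤ corners (misList-unique G) corners-into corners-injectiveOn)

  every-pattern-realised : 3 ^ length M ≤ mis G → ∀ p → Realisable p
  every-pattern-realised 3^|M|≤mis p = realised (onto (∈-vectors ∈-allFin p))
    where
    onto : ∀ {q} → q ∈ₗ vectors (allFin 3) (length M) → ∃ λ S → S ∈ₗ misList G × corners S ≡ q
    onto = injection⇒onto corners (misList-unique G) corners-into corners-injectiveOn
             (subst (_≤ mis G) (sym |patterns|) 3^|M|≤mis)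

    realised : (∃ λ S → S ∈ₗ misList G × corners S ≡ p) → Realisable p
    realised (S , S∈ , S↦p) = S , ∈-misList⁻ G S∈ , λ i →
      trans (sym (lookup∘tabulate (corner S) i)) (cong (λ v → lookup v i) S↦p)

  module Extremal (realise : ∀ p → Realisable p) where

    t : ℕ
    t = length M

    private
      module Realised (p : Vec (Fin 3) t) where
        S : Subset (n G)
        S = proj₁ (realise p)

        S-MIS : IsMIS G S
        S-MIS = proj₁ (proj₂ (realise p))

        S-ind : Independent G S
        S-ind = proj₁ S-MIS

        S-corner : ∀ i → corner S i ≡ lookup p i
        S-corner = proj₂ (proj₂ (realise p))

      a b : Fin t → Fin (n G)
      a i = endpoint M i 0F
      b i = endpoint M i 1F

    open Realised (replicate t 2F) using () renaming (S to S₂; S-MIS to S₂-MIS; S-corner to S₂-corner′)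

    S₂-corner : ∀ i → corner S₂ i ≡ 2F
    S₂-corner i = trans (S₂-corner′ i) (lookup-replicate i 2F)

    S₂-unmatched : ∀ {v} → v ∈ S₂ → ¬ Matched v
    S₂-unmatched v∈S₂ v∈E with i , s , refl ← ∈-endpoints⁻ M v∈E = corner-2F⇒∉ i s (S₂-corner i) v∈S₂

    apex-witness : ∀ i → ∃ λ x → x ∈ S₂ × adj G (a i) x ≡ true
    apex-witness i = MIS-dominates G S₂-MIS (corner-2F⇒∉ i 0F (S₂-corner i))

    apex : Fin t → Fin (n G)
    apex i = proj₁ (apex-witness i)

    apex-unmatched : ∀ i → ¬ Matched (apex i)
    apex-unmatched i = S₂-unmatched (proj₁ (proj₂ (apex-witness i)))

    a~apex : ∀ i → adj G (a i) (apex i) ≡ true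
    a~apex i = proj₂ (proj₂ (apex-witness i))

    b~apex : ∀ i → adj G (b i) (apex i) ≡ true
    b~apex i with y , y∈S₂ , b~y ← MIS-dominates G S₂-MIS (corner-2F⇒∉ i 1F (S₂-corner i)) with apex i ≟ y
    ... | yes refl = b~y
    ... | no x≢y   = ⊥-elim (no-augmenting-path i (apex-unmatched i) (S₂-unmatched y∈S₂) x≢y (a~apex i) b~y)

    unmatched-neighbour≡apex : ∀ i s {z} → ¬ Matched z → adj G (endpoint M i s) z ≡ true → z ≡ apex i
    unmatched-neighbour≡apex i s {z} z∉E e~z with z ≟ apex i | s
    ... | yes z≡x | _  = z≡x
    ... | no z≢x  | 0F = ⊥-elim (no-augmenting-path i z∉E (apex-unmatched i) z≢x e~z (b~apex i))
    ... | no z≢x  | 1F = ⊥-elim (no-augmenting-path i (apex-unmatched i) z∉E (z≢x ∘ sym) (a~apex i) e~z)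

    endpoints-nonadjacent : ∀ {i j} → i ≢ j → ∀ s s′ → adj G (endpoint M i s) (endpoint M j s′) ≡ false
    endpoints-nonadjacent {i} {j} i≢j s s′ = S-ind _ _ (corner⇒∈ i s corner-i) (corner⇒∈ j s′ corner-j)
      where
      pᵢ : Vec (Fin 3) t
      pᵢ = replicate t 2F [ i ]≔ inject₁ s

      open Realised (pᵢ [ j ]≔ inject₁ s′)

      corner-i : corner S i ≡ inject₁ s
      corner-i = trans (S-corner i)
        (trans (lookup∘update′ i≢j pᵢ (inject₁ s′)) (lookup∘update i (replicate t 2F) (inject₁ s)))

      corner-j : corner S j ≡ inject₁ s′
      corner-j = trans (S-corner j) (lookup∘update j pᵢ (inject₁ s′))

    -- For i ≢ j, realise the pattern containing a i and no other endpoint: the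
    -- neighbour of a j in that set is unmatched, hence is apex j, so apex j ≢ apex i.
    apex-injective : ∀ {i j} → apex i ≡ apex j → i ≡ j
    apex-injective {i} {j} xᵢ≡xⱼ with i ≟ j
    ... | yes i≡j = i≡j
    ... | no i≢j  = contradiction (trans (sym (a~apex i)) (S-ind _ _ aᵢ∈S xᵢ∈S)) λ ()
      where
      open Realised (replicate t 2F [ i ]≔ 0F)

      corner-off-i : ∀ {m} → m ≢ i → corner S m ≡ 2F
      corner-off-i {m} m≢i = trans (S-corner m)
        (trans (lookup∘update′ m≢i (replicate t 2F) 0F) (lookup-replicate m 2F))

      aᵢ∈S : a i ∈ S
      aᵢ∈S = corner⇒∈ i 0F (trans (S-corner i) (lookup∘update i (replicate t 2F) 0F))

      z-witness : ∃ λ z → z ∈ S × adj G (a j) z ≡ true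
      z-witness = MIS-dominates G S-MIS (corner-2F⇒∉ j 0F (corner-off-i (i≢j ∘ sym)))

      z : Fin (n G)
      z = proj₁ z-witness

      z∈S : z ∈ S
      z∈S = proj₁ (proj₂ z-witness)

      aⱼ~z : adj G (a j) z ≡ true
      aⱼ~z = proj₂ (proj₂ z-witness)

      z-unmatched : ¬ Matched z
      z-unmatched z∈E with m , s , z≡ ← ∈-endpoints⁻ M z∈E with m ≟ i
      ... | yes refl = contradiction (trans (sym aⱼ~z) (trans (cong (adj G (a j)) (sym z≡))
                         (endpoints-nonadjacent (i≢j ∘ sym) 0F s))) λ ()
      ... | no m≢i   = corner-2F⇒∉ m s (corner-off-i m≢i) (subst (_∈ S) (sym z≡) z∈S)

      xᵢ∈S : apex i ∈ S
      xᵢ∈S = subst (_∈ S) (trans (unmatched-neighbour≡apex j 0F z-unmatched aⱼ~z) (sym xᵢ≡xⱼ)) z∈S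

    endpoint≁other-apex : ∀ {i j} → i ≢ j → ∀ s → adj G (endpoint M i s) (apex j) ≡ false
    endpoint≁other-apex i≢j s = ¬-not λ e~xⱼ →
      i≢j (sym (apex-injective (unmatched-neighbour≡apex _ s (apex-unmatched _) e~xⱼ)))

    Isolated : Fin (n G) → Set
    Isolated v = ¬ Matched v × ∀ i → apex i ≢ v

    isolated? : ∀ v → Dec (Isolated v)
    isolated? v = ¬? (matched? v) ×-dec all? (λ i → ¬? (apex i ≟ v))

    isolated : List (Fin (n G))
    isolated = filter isolated? (allFin (n G))

    r : ℕ
    r = length isolated

    isolated-Isolated : ∀ j → Isolated (List.lookup isolated j)
    isolated-Isolated j = proj₂ (∈-filter⁻ isolated? {xs = allFin (n G)} (∈-lookup j))

    triangle : Fin t → Fin 3 → Fin (n G)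
    triangle i 0F = a i
    triangle i 1F = b i
    triangle i 2F = apex i

    triangle-adj : ∀ i j k l →
      adj G (triangle i k) (triangle j l) ≡ label-adj {t} {r} (inj₁ (i , k)) (inj₁ (j , l))
    triangle-adj i j k l with i ≟ j
    triangle-adj i _ 0F 0F | yes refl = irrefl G (a i)
    triangle-adj i _ 0F 1F | yes refl = endpoints-adjacent i
    triangle-adj i _ 0F 2F | yes refl = a~apex i
    triangle-adj i _ 1F 0F | yes refl = trans (adj-sym G (b i) (a i)) (endpoints-adjacent i)
    triangle-adj i _ 1F 1F | yes refl = irrefl G (b i)
    triangle-adj i _ 1F 2F | yes refl = b~apex i
    triangle-adj i _ 2F 0F | yes refl = trans (adj-sym G (apex i) (a i)) (a~apex i)
    triangle-adj i _ 2F 1F | yes refl = trans (adj-sym G (apex i) (b i)) (b~apex i)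
    triangle-adj i _ 2F 2F | yes refl = irrefl G (apex i)
    triangle-adj i j 0F 0F | no i≢j   = endpoints-nonadjacent i≢j 0F 0F
    triangle-adj i j 0F 1F | no i≢j   = endpoints-nonadjacent i≢j 0F 1F
    triangle-adj i j 0F 2F | no i≢j   = endpoint≁other-apex i≢j 0F
    triangle-adj i j 1F 0F | no i≢j   = endpoints-nonadjacent i≢j 1F 0F
    triangle-adj i j 1F 1F | no i≢j   = endpoints-nonadjacent i≢j 1F 1F
    triangle-adj i j 1F 2F | no i≢j   = endpoint≁other-apex i≢j 1F
    triangle-adj i j 2F 0F | no i≢j   = trans (adj-sym G (apex i) (a j)) (endpoint≁other-apex (i≢j ∘ sym) 0F)
    triangle-adj i j 2F 1F | no i≢j   = trans (adj-sym G (apex i) (b j)) (endpoint≁other-apex (i≢j ∘ sym) 1F)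
    triangle-adj i j 2F 2F | no i≢j   = unmatched-independent (apex-unmatched i) (apex-unmatched j)

    triangle≁isolated : ∀ i k j → adj G (triangle i k) (List.lookup isolated j) ≡ false
    triangle≁isolated i 2F j = unmatched-independent (apex-unmatched i) (proj₁ (isolated-Isolated j))
    triangle≁isolated i 0F j = ¬-not λ e~v →
      proj₂ (isolated-Isolated j) i (sym (unmatched-neighbour≡apex i 0F (proj₁ (isolated-Isolated j)) e~v))
    triangle≁isolated i 1F j = ¬-not λ e~v →
      proj₂ (isolated-Isolated j) i (sym (unmatched-neighbour≡apex i 1F (proj₁ (isolated-Isolated j)) e~v))

    vertexOf : Label t r → Fin (n G)
    vertexOf (inj₁ (i , k)) = triangle i k
    vertexOf (inj₂ j)       = List.lookup isolated j

    vertexOf-adj : ∀ x y → adj G (vertexOf x) (vertexOf y) ≡ label-adj x y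
    vertexOf-adj (inj₁ (i , k)) (inj₁ (j , l)) = triangle-adj i j k l
    vertexOf-adj (inj₁ (i , k)) (inj₂ j)       = triangle≁isolated i k j
    vertexOf-adj (inj₂ j)       (inj₁ (i , k)) = trans (adj-sym G _ (triangle i k)) (triangle≁isolated i k j)
    vertexOf-adj (inj₂ j)       (inj₂ j′)      =
      unmatched-independent (proj₁ (isolated-Isolated j)) (proj₁ (isolated-Isolated j′))

    triangle-not-isolated : ∀ i k → ¬ Isolated (triangle i k)
    triangle-not-isolated i 0F (v∉E , _) = v∉E (∈-endpoints M i 0F)
    triangle-not-isolated i 1F (v∉E , _) = v∉E (∈-endpoints M i 1F)
    triangle-not-isolated i 2F (_ , not-apex) = not-apex i refl

    endpoint≢apex : ∀ i j s → endpoint M i s ≢ apex j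
    endpoint≢apex i j s eq = apex-unmatched j (subst Matched eq (∈-endpoints M i s))

    triangle-injective : ∀ {i j k l} → triangle i k ≡ triangle j l → (i , k) ≡ (j , l)
    triangle-injective {i} {j} {0F} {0F} eq with refl , _  ← endpoint-injective M E! {i} {j} {0F} {0F} eq = refl
    triangle-injective {i} {j} {1F} {1F} eq with refl , _  ← endpoint-injective M E! {i} {j} {1F} {1F} eq = refl
    triangle-injective {i} {j} {0F} {1F} eq with _    , () ← endpoint-injective M E! {i} {j} {0F} {1F} eq
    triangle-injective {i} {j} {1F} {0F} eq with _    , () ← endpoint-injective M E! {i} {j} {1F} {0F} eq
    triangle-injective {i} {j} {0F} {2F} eq = ⊥-elim (endpoint≢apex i j 0F eq)
    triangle-injective {i} {j} {1F} {2F} eq = ⊥-elim (endpoint≢apex i j 1F eq)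
    triangle-injective {i} {j} {2F} {0F} eq = ⊥-elim (endpoint≢apex j i 0F (sym eq))
    triangle-injective {i} {j} {2F} {1F} eq = ⊥-elim (endpoint≢apex j i 1F (sym eq))
    triangle-injective {k = 2F} {2F} eq with refl ← apex-injective eq = refl

    vertexOf-injective : Injective _≡_ _≡_ vertexOf
    vertexOf-injective {inj₁ (i , k)} {inj₁ (j , l)} eq = cong inj₁ (triangle-injective eq)
    vertexOf-injective {inj₁ (i , k)} {inj₂ j}       eq =
      ⊥-elim (triangle-not-isolated i k (subst Isolated (sym eq) (isolated-Isolated j)))
    vertexOf-injective {inj₂ j}       {inj₁ (i , k)} eq =
      ⊥-elim (triangle-not-isolated i k (subst Isolated eq (isolated-Isolated j)))
    vertexOf-injective {inj₂ j}       {inj₂ j′}      eq =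
      cong inj₂ (Unique⇒lookup-injective (Unique.filter⁺ isolated? (Unique.allFin⁺ (n G))) eq)

    vertexOf-surjective : StrictlySurjective _≡_ vertexOf
    vertexOf-surjective v with matched? v
    ... | yes v∈E with ∈-endpoints⁻ M v∈E
    ...   | i , 0F , aᵢ≡v = inj₁ (i , 0F) , aᵢ≡v
    ...   | i , 1F , bᵢ≡v = inj₁ (i , 1F) , bᵢ≡v
    vertexOf-surjective v | no v∉E with any? (λ i → apex i ≟ v)
    ...   | yes (i , xᵢ≡v) = inj₁ (i , 2F) , xᵢ≡v
    ...   | no not-apex    = inj₂ (index v∈) , sym (lookup-index v∈)
      where
      v∈ : v ∈ₗ isolated
      v∈ = ∈-filter⁺ isolated? (∈-allFin v) (v∉E , λ i xᵢ≡v → not-apex (i , xᵢ≡v))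

    labelling : Labelling G t r
    labelling = record
      { vertex     = ⤖⇒↔ (mk⤖ (vertexOf-injective , strictlySurjective⇒surjective vertexOf-surjective))
      ; adj-vertex = vertexOf-adj
      }

    triangles∪isolated : ∃ λ r → G ≅ ((t ⊙ K 3) ∪ (r ⊙ K 1))
    triangles∪isolated = r , labellings⇒≅ labelling (triangles∪isolated-labelling t r)

theorem1 : (G : Graph) (t : ℕ) → MatchingNumber G t →
    mis G ≤ 3 ^ t × (mis G ≡ 3 ^ t ⇔ ∃ λ r → G ≅ ((t ⊙ K 3) ∪ (r ⊙ K 1)))
theorem1 G t ((M , M-matching , refl) , M-maximum) = mis≤3^|M| , mk⇔ extremal extremal⁻¹
  where
  open MaximumMatching G M M-matching M-maximum

  extremal : mis G ≡ 3 ^ t → ∃ λ r → G ≅ ((t ⊙ K 3) ∪ (r ⊙ K 1))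
  extremal mis≡3^t = Extremal.triangles∪isolated (every-pattern-realised (≤-reflexive (sym mis≡3^t)))

  extremal⁻¹ : (∃ λ r → G ≅ ((t ⊙ K 3) ∪ (r ⊙ K 1))) → mis G ≡ 3 ^ t
  extremal⁻¹ (r , G≅) = ≤-antisym mis≤3^|M| (3^t≤mis (≅-labelling G≅ (triangles∪isolated-labelling t r)))
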